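{- Let $q$ be an odd prime power, $d,k\ge1$. Let $h_1,\ldots,h_k\in\mathbb{F}_q[x_1,\ldots,x_d]$ be fixed polynomials of degree at most $q-1$ and $\mathbf{b}_i=(b_{i1},\ldots,b_{id})\in(\mathbb{Z}^+)^d$ fixed with $\gcd(b_{ij},q-1)=1$. For $\mathbf{a}_i=(a_{i1},\ldots,a_{i(d+1)})\in\mathbb{F}_q^{d+1}$ let $f_i(\mathbf{x},\mathbf{a}_i)=h_i(\mathbf{x})+\sum_{j=1}^da_{ij}x_j^{b_{ij}}+a_{i(d+1)}$ and $$V_{\mathbf{a}_1,\ldots,\mathbf{a}_k}=\{(\mathbf{x},x_{d+1},\ldots,x_{d+k})\in\mathbb{F}_q^{d+k}:x_{d+i}=f_i(\mathbf{x},\mathbf{a}_i),\ 1\le i\le k\}.$$ Then for any two $k$-tuples $(\mathbf{a}_1,\ldots,\mathbf{a}_k)\ne(\mathbf{c}_1,\ldots,\mathbf{c}_k)$ in $(\mathbb{F}_q^{d+1})^k$ we have $V_{\mathbf{a}_1,\ldots,\mathbf{a}_k}\ne V_{\mathbf{c}_1,\ldots,\mathbf{c}_k}$. -}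

module Defs where

open import Level using (_⊔_)
open import Algebra.Bundles using (CommutativeRing)
open import Data.Nat as ℕ using (ℕ; zero; suc; _^_; _%_; _≤_)
open import Data.Nat.Primality using (Prime)
open import Data.Fin using (Fin)
open import Data.Vec using (Vec; []; _∷_; lookup; init; last)
import Data.Vec as Vec
open import Data.List using (List; []; _∷_)
open import Data.List.Relation.Unary.All using (All)
open import Data.Product using (_×_; _,_; ∃; ∃₂)
open import Data.Sum using (_⊎_)
open import Relation.Nullary using (¬_)
open import Relation.Binary.PropositionalEquality using (_≡_)
import Relation.Binary.PropositionalEquality as ≡
open import Function.Bundles using (Inverse)

record IsFieldCR {c ℓ} (R : CommutativeRing c ℓ) : Set (c ⊔ ℓ) where
  open CommutativeRing R
  field
    1≉0 : ¬ (1# ≈ 0#)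
    inverse : ∀ x → ¬ (x ≈ 0#) → ∃ λ y → (x * y) ≈ 1#

HasCard : ∀ {c ℓ} (R : CommutativeRing c ℓ) → ℕ → Set _
HasCard R q = Inverse (CommutativeRing.setoid R) (≡.setoid (Fin q))

IsOddPrimePower : ℕ → Set
IsOddPrimePower q = ∃₂ λ p m → Prime p × 1 ≤ m × q ≡ p ^ m × q % 2 ≡ 1

module Poly {c ℓ} (R : CommutativeRing c ℓ) where
  open CommutativeRing R

  pow : Carrier → ℕ → Carrier
  pow x zero = 1#
  pow x (suc n) = x * pow x n

  Term : ℕ → Set c
  Term d = Carrier × Vec ℕ d

  Polynomial : ℕ → Set c
  Polynomial d = List (Term d)

  evalMono : ∀ {d} → Vec ℕ d → Vec Carrier d → Carrier
  evalMono [] [] = 1#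
  evalMono (e ∷ es) (x ∷ xs) = pow x e * evalMono es xs

  eval : ∀ {d} → Polynomial d → Vec Carrier d → Carrier
  eval [] x = 0#
  eval ((a , e) ∷ ts) x = a * evalMono e x + eval ts x

  DegreeAtMost : ∀ {d} → ℕ → Polynomial d → Set (c ⊔ ℓ)
  DegreeAtMost n p = All (λ t → (Data.Product.proj₁ t ≈ 0#) ⊎ Vec.sum (Data.Product.proj₂ t) ≤ n) p

  linPart : ∀ {d} → Vec Carrier d → Vec ℕ d → Vec Carrier d → Carrier
  linPart [] [] [] = 0#
  linPart (a ∷ as) (b ∷ bs) (x ∷ xs) = a * pow x b + linPart as bs xs

  fPoly : ∀ {d} → Polynomial d → Vec ℕ d → Vec Carrier (suc d) → Vec Carrier d → Carrier
  fPoly h b a x = eval h x + linPart (init a) b x + last a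

  -- membership of the point (x, y) ∈ F^d × F^k (= F^{d+k}) in V_{a_1..a_k}
  V : ∀ {d k} → Vec (Polynomial d) k → Vec (Vec ℕ d) k → Vec (Vec Carrier (suc d)) k
      → Vec Carrier d → Vec Carrier k → Set ℓ
  V h b a x y = ∀ i → lookup y i ≈ fPoly (lookup h i) (lookup b i) (lookup a i) x

module Submission where

open import Defs
open import Algebra.Bundles using (CommutativeRing)
open import Data.Nat using (ℕ; zero; suc; _≤_; _∸_)
open import Data.Nat.GCD using (gcd)
open import Data.Vec using (Vec; []; _∷_; lookup; _∷ʳ_; init; last; initLast; replicate; tabulate)
open import Data.Vec.Properties using (lookup∘tabulate)
open import Data.Vec.Relation.Unary.All using (All; []; _∷_)
import Data.Vec.Relation.Unary.All.Properties as All
open import Data.Vec.Relation.Binary.Pointwise.Inductive as Pointwise using (Pointwise; []; _∷_)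
open import Data.Product using (_×_; _,_; proj₁)
open import Function using (_∘_)
open import Relation.Binary.Core using (Rel)
open import Relation.Nullary using (¬_)
open import Relation.Binary.PropositionalEquality using (_≡_) renaming (refl to ≡-refl)
import Algebra.Properties.Group as GroupProperties
import Relation.Binary.Reasoning.Setoid as SetoidReasoning

-- V_a is the graph of x ↦ (f_1(x, a_1), …, f_k(x, a_k)), so V_a = V_c forces
-- f_i(-, a_i) = f_i(-, c_i) as functions on F^d.  Since every b_ij ≥ 1, we have
-- 0^b = 0 and 1^b = 1, so evaluating at 0 recovers a_{i(d+1)} and evaluating at
-- the unit vectors recovers a_{ij}.

module _ {a r} {A : Set a} {_∼_ : Rel A r} where

  ∷ʳ⁺ : ∀ {n} {xs ys : Vec A n} {x y} → Pointwise _∼_ xs ys → x ∼ y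
      → Pointwise _∼_ (xs ∷ʳ x) (ys ∷ʳ y)
  ∷ʳ⁺ []          x∼y = x∼y ∷ []
  ∷ʳ⁺ (p ∷ xs∼ys) x∼y = p ∷ ∷ʳ⁺ xs∼ys x∼y

  init-last⁺ : ∀ {n} (xs ys : Vec A (suc n))
             → Pointwise _∼_ (init xs) (init ys) → last xs ∼ last ys → Pointwise _∼_ xs ys
  init-last⁺ xs ys with initLast xs | initLast ys
  ... | _ , _ , ≡-refl | _ , _ , ≡-refl = ∷ʳ⁺

module _ {c ℓ} (R : CommutativeRing c ℓ) where
  open CommutativeRing R
  open Poly R
  open GroupProperties +-group using (∙-cancelˡ; ∙-cancelʳ)
  open SetoidReasoning setoid

  pow-0# : ∀ {n} → 1 ≤ n → pow 0# n ≈ 0#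
  pow-0# {suc n} _ = zeroˡ (pow 0# n)

  pow-1# : ∀ n → pow 1# n ≈ 1#
  pow-1# zero    = refl
  pow-1# (suc n) = trans (*-identityˡ _) (pow-1# n)

  zeros : ∀ {d} → Vec Carrier d
  zeros = replicate _ 0#

  linPart-zeros : ∀ {d} (as : Vec Carrier d) {bs} → All (1 ≤_) bs → linPart as bs zeros ≈ 0#
  linPart-zeros []                []           = refl
  linPart-zeros (a ∷ as) {b ∷ bs} (b≥1 ∷ bs≥1) = begin
    a * pow 0# b + linPart as bs zeros ≈⟨ +-cong (*-congˡ (pow-0# b≥1)) (linPart-zeros as bs≥1) ⟩
    a * 0# + 0#                        ≈⟨ +-identityʳ _ ⟩
    a * 0#                             ≈⟨ zeroʳ a ⟩
    0#                                 ∎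

  linPart-unit : ∀ {d} a (as : Vec Carrier d) b {bs} → All (1 ≤_) bs
               → linPart (a ∷ as) (b ∷ bs) (1# ∷ zeros) ≈ a
  linPart-unit a as b {bs} bs≥1 = begin
    a * pow 1# b + linPart as bs zeros ≈⟨ +-cong (*-congˡ (pow-1# b)) (linPart-zeros as bs≥1) ⟩
    a * 1# + 0#                        ≈⟨ +-identityʳ _ ⟩
    a * 1#                             ≈⟨ *-identityʳ a ⟩
    a                                  ∎

  linPart-0#∷ : ∀ {d} a (as : Vec Carrier d) {b} bs → 1 ≤ b → ∀ x
              → linPart (a ∷ as) (b ∷ bs) (0# ∷ x) ≈ linPart as bs x
  linPart-0#∷ a as {b} bs b≥1 x = begin
    a * pow 0# b + linPart as bs x ≈⟨ +-congʳ (trans (*-congˡ (pow-0# b≥1)) (zeroʳ a)) ⟩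
    0# + linPart as bs x           ≈⟨ +-identityˡ _ ⟩
    linPart as bs x                ∎

  linPart-injective : ∀ {d} {as as′ : Vec Carrier d} {bs} → All (1 ≤_) bs
                    → (∀ x → linPart as bs x ≈ linPart as′ bs x) → Pointwise _≈_ as as′
  linPart-injective {as = []} {[]} [] _ = []
  linPart-injective {as = a ∷ as} {a′ ∷ as′} {b ∷ bs} (b≥1 ∷ bs≥1) same = head ∷ tail
    where
    head : a ≈ a′
    head = begin
      a                                         ≈⟨ linPart-unit a as b bs≥1 ⟨
      linPart (a ∷ as) (b ∷ bs) (1# ∷ zeros)    ≈⟨ same (1# ∷ zeros) ⟩
      linPart (a′ ∷ as′) (b ∷ bs) (1# ∷ zeros)  ≈⟨ linPart-unit a′ as′ b bs≥1 ⟩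
      a′                                        ∎
    tail : Pointwise _≈_ as as′
    tail = linPart-injective bs≥1 λ x → begin
      linPart as bs x                       ≈⟨ linPart-0#∷ a as bs b≥1 x ⟨
      linPart (a ∷ as) (b ∷ bs) (0# ∷ x)    ≈⟨ same (0# ∷ x) ⟩
      linPart (a′ ∷ as′) (b ∷ bs) (0# ∷ x)  ≈⟨ linPart-0#∷ a′ as′ bs b≥1 x ⟩
      linPart as′ bs x                      ∎

  fPoly-injective : ∀ {d} (h : Polynomial d) {bs} → All (1 ≤_) bs → (a a′ : Vec Carrier (suc d))
                  → (∀ x → fPoly h bs a x ≈ fPoly h bs a′ x) → Pointwise _≈_ a a′
  fPoly-injective h {bs} bs≥1 a a′ same = init-last⁺ a a′ init≋ last≈
    where
    affine≈ : ∀ x → linPart (init a) bs x + last a ≈ linPart (init a′) bs x + last a′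
    affine≈ x = ∙-cancelˡ (eval h x) _ _ (trans (sym (+-assoc _ _ _)) (trans (same x) (+-assoc _ _ _)))
    last≈ : last a ≈ last a′
    last≈ = begin
      last a                                 ≈⟨ +-identityˡ _ ⟨
      0# + last a                            ≈⟨ +-congʳ (linPart-zeros (init a) bs≥1) ⟨
      linPart (init a) bs zeros + last a     ≈⟨ affine≈ zeros ⟩
      linPart (init a′) bs zeros + last a′   ≈⟨ +-congʳ (linPart-zeros (init a′) bs≥1) ⟩
      0# + last a′                           ≈⟨ +-identityˡ _ ⟩
      last a′                                ∎
    init≋ : Pointwise _≈_ (init a) (init a′)
    init≋ = linPart-injective bs≥1 λ x →
      ∙-cancelʳ (last a) _ _ (trans (affine≈ x) (+-congˡ (sym last≈)))

  module _ {d k} (h : Vec (Polynomial d) k) (b : Vec (Vec ℕ d) k) where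

    graph : Vec (Vec Carrier (suc d)) k → Vec Carrier d → Vec Carrier k
    graph a x = tabulate λ i → fPoly (lookup h i) (lookup b i) (lookup a i) x

    graph∈V : ∀ a x → V h b a x (graph a x)
    graph∈V a x i = reflexive (lookup∘tabulate _ i)

    V⊆V⇒fPoly≈ : ∀ a a′ → (∀ x y → V h b a x y → V h b a′ x y)
               → ∀ i x → fPoly (lookup h i) (lookup b i) (lookup a i) x
                         ≈ fPoly (lookup h i) (lookup b i) (lookup a′ i) x
    V⊆V⇒fPoly≈ a a′ V⊆V i x = trans (sym (graph∈V a x i)) (V⊆V x (graph a x) (graph∈V a x) i)

lemma3p1 : ∀ {c ℓ} (R : CommutativeRing c ℓ) → IsFieldCR R
    → (q : ℕ) → HasCard R q → IsOddPrimePower q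
    → (d k : ℕ) → 1 ≤ d → 1 ≤ k
    → (h : Vec (Poly.Polynomial R d) k) → All (Poly.DegreeAtMost R (q ∸ 1)) h
    → (b : Vec (Vec ℕ d) k)
    → (∀ i j → 1 ≤ lookup (lookup b i) j × gcd (lookup (lookup b i) j) (q ∸ 1) ≡ 1)
    → (a a′ : Vec (Vec (CommutativeRing.Carrier R) (suc d)) k)
    → ¬ (∀ i j → CommutativeRing._≈_ R (lookup (lookup a i) j) (lookup (lookup a′ i) j))
    → ¬ (∀ x y → (Poly.V R h b a x y → Poly.V R h b a′ x y) × (Poly.V R h b a′ x y → Poly.V R h b a x y))
lemma3p1 R _ _ _ _ d k _ _ h _ b b-conditions a a′ a≉a′ V≡V = a≉a′ λ i →
  Pointwise.lookup (fPoly-injective R (lookup h i) (b≥1 i) (lookup a i) (lookup a′ i)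
                                    (V⊆V⇒fPoly≈ R h b a a′ (λ x y → proj₁ (V≡V x y)) i))
  where
  b≥1 : ∀ i → All (1 ≤_) (lookup b i)
  b≥1 i = All.lookup⁻ (proj₁ ∘ b-conditions i)
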